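{- Let $\omega,\gamma$ be linear-time specifications over $E\cup A$ with $\omega$ an environment assumption, and let $U$ be the universal domain over $E,A$. Let $P=((U,\omega),\gamma)$. Then for every agent strategy $\sigma_{ag}$: $\sigma_{ag}$ solves $P$ if and only if $\sigma_{ag}$ realizes $\gamma$ assuming $\omega$.
   Context: $E,A$ are disjoint non-empty finite sets of Boolean variables, $\mathcal{E}=2^E$, $\mathcal{A}=2^A$. Traces are infinite sequences $\pi_0\pi_1\cdots$ of subsets of $E\cup A$; a specification $\phi$ defines a set $[[\phi]]$ of traces. An agent strategy is $\sigma_{ag}:\mathcal{E}^+\to\mathcal{A}$, an environment strategy is $\sigma_{env}:\mathcal{A}^*\to\mathcal{E}$; their play $\pi_{\sigma_{ag},\sigma_{env}}$ is the unique trace with $\pi_0\cap E=\sigma_{env}(\varepsilon)$, $\pi_{k+1}\cap E=\sigma_{env}((\pi_0\cap A)\cdots(\pi_k\cap A))$, $\pi_k\cap A=\sigma_{ag}((\pi_0\cap E)\cdots(\pi_k\cap E))$. An environment strategy realizes $\phi$ if against every agent strategy the play lies in $[[\phi]]$; $\omega$ is an environment assumption if some environment strategy realizes it. An agent strategy $\sigma_{ag}$ realizes $\gamma$ assuming $\omega$ if for every environment strategy $\sigma_{env}$ realizing $\omega$, $\pi_{\sigma_{ag},\sigma_{env}}\in[[\gamma]]$. A domain is $D=(E,A,I,Pre,\Delta)$ with non-empty $I\subseteq\mathcal{E}$, $Pre\subseteq\mathcal{E}\times\mathcal{A}$ (every $s$ has some $a$ with $(s,a)\in Pre$, "$a$ available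 in $s$"), $\Delta\subseteq\mathcal{E}\times\mathcal{A}\times\mathcal{E}$ with $(s,a,t)\in\Delta\Rightarrow(s,a)\in Pre$. $\omega_D$ is the set of traces with $\pi_0\cap E\in I$ and such that for all $n\ge1$, if $\pi_i\cap A$ is available in $\pi_i\cap E$ for all $i\in[0,n-1]$ then $(\pi_{n-1}\cap E,\pi_{n-1}\cap A,\pi_n\cap E)\in\Delta$. The universal domain is $U=(E,A,\mathcal{E},\mathcal{E}\times\mathcal{A},\mathcal{E}\times\mathcal{A}\times\mathcal{E})$. For a domain $D$ and specifications $\omega,\gamma$ such that some environment strategy realizes $\omega_D\wedge\omega$, an agent strategy $\sigma_{ag}$ solves the planning under assumptions problem $((D,\omega),\gamma)$ if for every environment strategy $\sigma_{env}$ realizing $\omega_D\wedge\omega$, $\pi_{\sigma_{ag},\sigma_{env}}\in[[\gamma]]$. -}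

module Defs where

open import Data.Nat using (ℕ; zero; suc; _≤_)
import Data.Fin.Subset
open Data.Fin.Subset using (Subset)
open import Data.List using (List; [])
import Data.List as List
open import Data.List.NonEmpty using (List⁺; [_]; _⁺∷ʳ_; last)
open import Data.Product using (_×_; _,_; proj₁; proj₂; ∃)
open import Data.Unit using (⊤)

-- E = Fin nE and A = Fin nA (disjoint sets of Boolean variables);
-- 𝓔 = 2^E and 𝓐 = 2^A are represented by Subset nE / Subset nA.
module Game (nE nA : ℕ) where

  Env : Set
  Env = Subset nE

  Act : Set
  Act = Subset nA

  -- A subset of E ∪ A (E, A disjoint) is a pair (π ∩ E , π ∩ A).
  Trace : Set
  Trace = ℕ → Env × Act

  Spec : Set₁
  Spec = Trace → Set

  _∧ₛ_ : Spec → Spec → Spec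
  (φ ∧ₛ ψ) π = φ π × ψ π

  -- σ_ag : 𝓔⁺ → 𝓐   (sequences listed oldest first)
  AgStrat : Set
  AgStrat = List⁺ Env → Act

  EnvStrat : Set
  EnvStrat = List Act → Env

  module _ (σag : AgStrat) (σenv : EnvStrat) where
    mutual
      -- (π₀ ∩ E) ⋯ (πₖ ∩ E)
      envs : ℕ → List⁺ Env
      envs zero    = [ σenv [] ]
      envs (suc k) = envs k ⁺∷ʳ σenv (acts (suc k))

      -- (π₀ ∩ A) ⋯ (πₖ₋₁ ∩ A)
      acts : ℕ → List Act
      acts zero    = []
      acts (suc k) = acts k List.∷ʳ σag (envs k)

    play : Trace
    play k = last (envs k) , σag (envs k)

  RealizesEnv : EnvStrat → Spec → Set
  RealizesEnv σenv φ = (σag : AgStrat) → φ (play σag σenv)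

  EnvAssumption : Spec → Set
  EnvAssumption ω = ∃ λ σenv → RealizesEnv σenv ω

  RealizesAssuming : AgStrat → Spec → Spec → Set
  RealizesAssuming σag γ ω =
    (σenv : EnvStrat) → RealizesEnv σenv ω → γ (play σag σenv)

  record Domain : Set₁ where
    field
      I    : Env → Set
      Pre  : Env → Act → Set
      Δ    : Env → Act → Env → Set
      I-nonempty : ∃ I
      Pre-total  : ∀ s → ∃ (Pre s)
      Δ⊆Pre      : ∀ s a t → Δ s a t → Pre s a

  -- ω_D, indexed by m = n - 1 ≥ 0
  ωD : Domain → Spec
  ωD D π =
    I (proj₁ (π 0)) ×
    ((m : ℕ) → ((i : ℕ) → i ≤ m → Pre (proj₁ (π i)) (proj₂ (π i))) →
      Δ (proj₁ (π m)) (proj₂ (π m)) (proj₁ (π (suc m))))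
    where open Domain D

  Universal : Domain
  Universal = record
    { I = λ _ → ⊤ ; Pre = λ _ _ → ⊤ ; Δ = λ _ _ _ → ⊤
    ; I-nonempty = (Data.Fin.Subset.⊥ , _)
    ; Pre-total = λ _ → (Data.Fin.Subset.⊥ , _)
    ; Δ⊆Pre = λ _ _ _ _ → _ }

  -- σag solves ((D, ω), γ) (well-posedness, i.e. realizability of ω_D ∧ ω,
  -- is a side condition of the problem, supplied in the theorem).
  Solves : Domain → Spec → Spec → AgStrat → Set
  Solves D ω γ σag =
    (σenv : EnvStrat) → RealizesEnv σenv (ωD D ∧ₛ ω) → γ (play σag σenv)

module Submission where

-- The universal domain imposes no constraint at all: every initial state is
-- allowed, every action is available and every transition belongs to Δ, so
-- every trace satisfies ω_U.  Hence an environment strategy realizes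
-- ω_U ∧ ω exactly when it realizes ω, and the two notions of "solving"
-- quantify over the same environment strategies.  The
-- hypotheses that E and A are non-empty and that ω is an environment
-- assumption are part of the problem setting but not needed for the proof.

open import Defs
open import Data.Nat using (ℕ; _≤_)
open import Function.Bundles using (_⇔_; mk⇔; Equivalence)
open import Data.Product using (_,_; proj₂)

module _ {nE nA : ℕ} where
  open Game nE nA

  ωU-holds : (π : Trace) → ωD Universal π
  ωU-holds π = _ , λ _ _ → _

  realizes-ωU∧⇔realizes : (σenv : EnvStrat) (ω : Spec) →
    RealizesEnv σenv (ωD Universal ∧ₛ ω) ⇔ RealizesEnv σenv ω
  realizes-ωU∧⇔realizes σenv ω =
    mk⇔ (λ r σag → proj₂ (r σag))
        (λ r σag → ωU-holds (play σag σenv) , r σag)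

  solves-universal⇔realizes-assuming : (ω γ : Spec) (σag : AgStrat) →
    Solves Universal ω γ σag ⇔ RealizesAssuming σag γ ω
  solves-universal⇔realizes-assuming ω γ σag = mk⇔
    (λ solves σenv r → solves σenv (Equivalence.from (realizes-ωU∧⇔realizes σenv ω) r))
    (λ realizes σenv r → realizes σenv (Equivalence.to (realizes-ωU∧⇔realizes σenv ω) r))

theorem6 : (nE nA : ℕ) → 1 ≤ nE → 1 ≤ nA →
    let open Game nE nA in
    (ω γ : Spec) → EnvAssumption ω → (σag : AgStrat) →
    Solves Universal ω γ σag ⇔ RealizesAssuming σag γ ω
theorem6 nE nA _ _ ω γ _ σag = solves-universal⇔realizes-assuming ω γ σag
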